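{- Let $G$ be a connected graph with at least three vertices. The following are equivalent: (i) $G$ is diametrical bipartite; (ii) the weighted graph $\mathcal G_G$ is bipartite; (iii) every adjacency-diametrical cycle of $G$ has even length.
   Context: All graphs are finite, simple, undirected. For a connected graph $G$ with diameter $d$, two distinct vertices are antipodal if their distance is $d$. $G$ is diametrical bipartite if it is bipartite with bipartition $(V_1,V_2)$ and no two vertices in the same part are antipodal. The associated weighted graph $\mathcal G_G$ has vertex set $V(G)$, and two vertices are joined by an edge of weight $1$ if they are adjacent in $G$ and of weight $d$ if they are antipodal in $G$ (no other edges). An adjacency-diametrical cycle of length $k\ge3$ is a cyclic arrangement $(u_1,\dots,u_k)$ of $k$ distinct vertices such that each consecutive pair $u_i,u_{i+1}$ (indices mod $k$) is adjacent or antipodal in $G$. -}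

module Defs where

open import Level using (0ℓ)
open import Data.Nat using (ℕ; zero; suc; _≤_)
open import Data.Nat.Divisibility using (_∣_)
open import Data.Fin using (Fin; inject₁; fromℕ) renaming (zero to fzero; suc to fsuc)
open import Data.Product using (Σ; _×_; ∃; ∃-syntax; _,_)
open import Data.Sum using (_⊎_)
open import Data.Bool using (Bool)
open import Function.Definitions using (Injective)
open import Relation.Binary.PropositionalEquality using (_≡_; _≢_)
open import Relation.Nullary using (¬_)

record SimpleGraph (n : ℕ) : Set₁ where
  field
    Adj     : Fin n → Fin n → Set
    symAdj  : ∀ {u v} → Adj u v → Adj v u
    irrAdj  : ∀ {u} → ¬ Adj u u
open SimpleGraph public

module _ {n : ℕ} (G : SimpleGraph n) where

  data Walk : Fin n → Fin n → ℕ → Set where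
    nil  : ∀ {u} → Walk u u 0
    cons : ∀ {u v w k} → Adj G u v → Walk v w k → Walk u w (suc k)

  Connected : Set
  Connected = ∀ u v → ∃[ k ] Walk u v k

  IsDist : Fin n → Fin n → ℕ → Set
  IsDist u v d = Walk u v d × (∀ k → Walk u v k → d ≤ k)

  IsDiam : ℕ → Set
  IsDiam d = (∀ u v e → IsDist u v e → e ≤ d) × (∃[ u ] ∃[ v ] IsDist u v d)

  Antipodal : Fin n → Fin n → Set
  Antipodal u v = u ≢ v × (∃[ d ] (IsDiam d × IsDist u v d))

  -- A bipartition (V₁,V₂) encoded by a colouring c (V₁ = c⁻¹ true).
  IsBipartition : (Fin n → Bool) → Set
  IsBipartition c = ∀ u v → Adj G u v → c u ≢ c v

  Bipartite : Set
  Bipartite = Σ (Fin n → Bool) IsBipartition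

  DiametricalBipartite : Set
  DiametricalBipartite =
    Σ (Fin n → Bool) λ c → (IsBipartition c × (∀ u v → Antipodal u v → c u ≢ c v))

  WEdge : Fin n → Fin n → ℕ → Set
  WEdge u v w = (Adj G u v × w ≡ 1) ⊎ (Antipodal u v × (∃[ d ] (IsDiam d × w ≡ d)))

  -- A weighted graph is bipartite iff its underlying graph is.
  WeightedBipartite : Set
  WeightedBipartite = Σ (Fin n → Bool) λ c → (∀ u v (w : ℕ) → WEdge u v w → c u ≢ c v)

  AdjOrAntipodal : Fin n → Fin n → Set
  AdjOrAntipodal u v = Adj G u v ⊎ Antipodal u v

  -- Adjacency-diametrical cycle of length suc m (≥ 3): distinct vertices
  -- u₀,…,u_m with consecutive ones (cyclically) adjacent or antipodal.
  record ADCycle (m : ℕ) : Set where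
    field
      len≥3    : 3 ≤ suc m
      vert     : Fin (suc m) → Fin n
      distinct : Injective _≡_ _≡_ vert
      step     : ∀ (i : Fin m) → AdjOrAntipodal (vert (inject₁ i)) (vert (fsuc i))
      close    : AdjOrAntipodal (vert (fromℕ m)) (vert fzero)

  AllADCyclesEven : Set
  AllADCyclesEven = ∀ m → ADCycle m → 2 ∣ suc m

{-# OPTIONS --safe #-}
module Submission where

-- All three conditions say that the graph whose edges are the adjacent or antipodal pairs has a
-- proper 2-colouring. Along a cycle
-- a proper 2-colouring alternates, so cycles are even. Conversely, colour v by the parity of a
-- fixed walk from a base vertex v₀. If an adjacent or antipodal pair u, v got the same colour,
-- the closed walk v → v₀ → u → v would be odd. A shortest odd closed walk repeats no vertex,
-- since at a repetition it splits into two shorter closed walks one of which is odd; it cannot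
-- have length 1 (no loops), so it is an odd adjacency-diametrical cycle.

open import Defs
open import Data.Bool using (Bool; true; false; not; _xor_)
open import Data.Bool.Properties
  using (not-involutive; not-distribˡ-xor; not-distribʳ-xor; xor-same; xor-identityʳ; ¬-not)
open import Data.Empty using (⊥; ⊥-elim)
open import Data.Fin using (Fin; inject₁; fromℕ; _≟_) renaming (zero to fzero; suc to fsuc)
open import Data.List using (List; []; _∷_; _++_; length; lookup)
open import Data.List.Properties using (length-++; length-++-sucʳ)
open import Data.List.Membership.Propositional.Properties using (∈-lookup; ∈-∃++)
import Data.List.Membership.DecPropositional as DecMembership
import Data.List.Relation.Unary.All as All
open import Data.List.Relation.Unary.All.Properties using (¬Any⇒All¬)
open import Data.List.Relation.Unary.Unique.Propositional using (Unique; []; _∷_)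
open import Data.Nat using (ℕ; zero; suc; _+_; _*_; _≤_; _<_; z≤n; s≤s)
open import Data.Nat.Divisibility using (_∣_; divides; _∣0; ∣-refl; ∣m∣n⇒∣m+n)
open import Data.Nat.Induction using (<-wellFounded)
open import Data.Nat.Properties using (+-suc; +-identityʳ; +-comm; +-assoc; m<m+n; m<n+m)
open import Data.Product using (Σ; _×_; ∃-syntax; _,_; proj₁; proj₂)
open import Data.Sum using (_⊎_; inj₁; inj₂; [_,_]′)
open import Function.Base using (_∘_)
open import Function.Bundles using (_⇔_; mk⇔)
import Function.Properties.Equivalence as ⇔
open import Induction.WellFounded using (Acc; acc)
open import Relation.Binary.Definitions using (DecidableEquality)
open import Relation.Binary.PropositionalEquality
  using (_≡_; _≢_; ≢-sym; refl; sym; trans; cong; subst; module ≡-Reasoning)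
open import Relation.Nullary using (¬_; yes; no)

odd : ℕ → Bool
odd zero    = false
odd (suc n) = not (odd n)

odd-+ : ∀ m n → odd (m + n) ≡ odd m xor odd n
odd-+ zero    n = refl
odd-+ (suc m) n = trans (cong not (odd-+ m n)) (not-distribˡ-xor (odd m) (odd n))

odd-+⁻ : ∀ m n → odd (m + n) ≡ true → odd m ≡ true ⊎ odd n ≡ true
odd-+⁻ m n o with odd m | odd n | trans (sym (odd-+ m n)) o
... | true  | _    | _ = inj₁ refl
... | false | true | _ = inj₂ refl

odd≡false⇒2∣ : ∀ n → odd n ≡ false → 2 ∣ n
odd≡false⇒2∣ zero          _ = 2 ∣0
odd≡false⇒2∣ (suc (suc n)) e =
  ∣m∣n⇒∣m+n ∣-refl (odd≡false⇒2∣ n (trans (sym (not-involutive (odd n))) e))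

2∣⇒odd≡false : ∀ {n} → 2 ∣ n → odd n ≡ false
2∣⇒odd≡false (divides q refl) = odd-*2 q
  where
  odd-*2 : ∀ q → odd (q * 2) ≡ false
  odd-*2 zero    = refl
  odd-*2 (suc q) = trans (not-involutive (odd (q * 2))) (odd-*2 q)

module _ {A : Set} (R : A → A → Set) where

  data Path : A → A → List A → Set where
    edge : ∀ {a b} → R a b → Path a b []
    _◅_  : ∀ {a x b xs} → R a x → Path x b xs → Path a b (x ∷ xs)

  infixr 5 _◅_

  -- A closed walk visiting the vertices xs in order has exactly length xs edges.
  ClosedWalk : List A → Set
  ClosedWalk []       = ⊥
  ClosedWalk (x ∷ xs) = Path x x xs

module _ {A : Set} {R : A → A → Set} where

  Path-++⁻ : ∀ {a b z} xs {ys} → Path R a b (xs ++ z ∷ ys) → Path R a z xs × Path R z b ys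
  Path-++⁻ []       (r ◅ p) = edge r , p
  Path-++⁻ (x ∷ xs) (r ◅ p) = let (p₁ , p₂) = Path-++⁻ xs p in r ◅ p₁ , p₂

  Path-++⁺ : ∀ {a b z xs ys} → Path R a z xs → Path R z b ys → Path R a b (xs ++ z ∷ ys)
  Path-++⁺ (edge r) q = r ◅ q
  Path-++⁺ (r ◅ p)  q = r ◅ Path-++⁺ p q

  Path-step : ∀ {a b xs} → Path R a b xs → (i : Fin (length xs)) →
              R (lookup (a ∷ xs) (inject₁ i)) (lookup (a ∷ xs) (fsuc i))
  Path-step (r ◅ p) fzero    = r
  Path-step (r ◅ p) (fsuc i) = Path-step p i

  Path-close : ∀ {a b xs} → Path R a b xs → R (lookup (a ∷ xs) (fromℕ (length xs))) b
  Path-close (edge r) = r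
  Path-close (r ◅ p)  = Path-close p

  ClosedWalk-split : ∀ xs {z} ys zs → ClosedWalk R (xs ++ z ∷ ys ++ z ∷ zs) →
                     ClosedWalk R (z ∷ ys) × ClosedWalk R (xs ++ z ∷ zs)
  ClosedWalk-split []       ys zs w = Path-++⁻ ys w
  ClosedWalk-split (x ∷ xs) ys zs w =
    let (p , q) = Path-++⁻ xs w; (c , q′) = Path-++⁻ ys q in c , Path-++⁺ p q′

data Repeats {A : Set} : List A → Set where
  repeats : ∀ xs z ys zs → Repeats (xs ++ z ∷ ys ++ z ∷ zs)

unique⊎repeats : ∀ {A : Set} → DecidableEquality A → (xs : List A) → Unique xs ⊎ Repeats xs
unique⊎repeats _≟_ []       = inj₁ []
unique⊎repeats _≟_ (x ∷ xs) with DecMembership._∈?_ _≟_ x xs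
... | yes x∈xs with ∈-∃++ x∈xs
...   | ys , zs , refl = inj₂ (repeats [] x ys zs)
unique⊎repeats _≟_ (x ∷ xs) | no x∉xs with unique⊎repeats _≟_ xs
... | inj₁ u                   = inj₁ (¬Any⇒All¬ xs x∉xs ∷ u)
... | inj₂ (repeats as z bs cs) = inj₂ (repeats (x ∷ as) z bs cs)

lookup-injective : ∀ {A : Set} {xs : List A} → Unique xs → ∀ {i j} → lookup xs i ≡ lookup xs j → i ≡ j
lookup-injective {xs = _ ∷ _}  (x∉ ∷ u) {fzero}  {fzero}  e = refl
lookup-injective {xs = _ ∷ xs} (x∉ ∷ u) {fzero}  {fsuc j} e = ⊥-elim (All.lookup x∉ (∈-lookup j) e)
lookup-injective {xs = _ ∷ xs} (x∉ ∷ u) {fsuc i} {fzero}  e = ⊥-elim (All.lookup x∉ (∈-lookup i) (sym e))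
lookup-injective {xs = _ ∷ _}  (x∉ ∷ u) {fsuc i} {fsuc j} e = cong fsuc (lookup-injective u e)

length-repeats : ∀ {A : Set} xs (z : A) ys zs →
                 length (xs ++ z ∷ ys ++ z ∷ zs) ≡ length (z ∷ ys) + length (xs ++ z ∷ zs)
length-repeats xs z ys zs = begin
  length (xs ++ z ∷ ys ++ z ∷ zs)          ≡⟨ length-++ xs ⟩
  |xs| + suc (length (ys ++ z ∷ zs))       ≡⟨ cong (λ n → |xs| + suc n) (length-++ ys) ⟩
  |xs| + (suc |ys| + |z∷zs|)               ≡⟨ sym (+-assoc |xs| (suc |ys|) |z∷zs|) ⟩
  |xs| + suc |ys| + |z∷zs|                 ≡⟨ cong (_+ |z∷zs|) (+-comm |xs| (suc |ys|)) ⟩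
  suc |ys| + |xs| + |z∷zs|                 ≡⟨ +-assoc (suc |ys|) |xs| |z∷zs| ⟩
  suc |ys| + (|xs| + |z∷zs|)               ≡⟨ cong (suc |ys| +_) (sym (length-++ xs)) ⟩
  suc |ys| + length (xs ++ z ∷ zs)         ∎
  where
  open ≡-Reasoning
  |xs| = length xs
  |ys| = length ys
  |z∷zs| = length (z ∷ zs)

module _ {A : Set} (_≟_ : DecidableEquality A) {R : A → A → Set} where

  oddClosedWalk⇒oddCycle : ∀ xs → ClosedWalk R xs → odd (length xs) ≡ true →
                           ∃[ ys ] (Unique ys × ClosedWalk R ys × odd (length ys) ≡ true)
  oddClosedWalk⇒oddCycle xs = go xs (<-wellFounded (length xs))
    where
    go : ∀ xs → Acc _<_ (length xs) → ClosedWalk R xs → odd (length xs) ≡ true →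
         ∃[ ys ] (Unique ys × ClosedWalk R ys × odd (length ys) ≡ true)
    go xs (acc shorter) w o with unique⊎repeats _≟_ xs
    ... | inj₁ u = xs , u , w , o
    ... | inj₂ (repeats as z bs cs) =
      let (c , c′) = ClosedWalk-split as bs cs w in
      [ go (z ∷ bs) (shorter (subst (_ <_) (sym total) (m<m+n _ 0<rest))) c
      , go (as ++ z ∷ cs) (shorter (subst (_ <_) (sym total) (m<n+m _ (s≤s z≤n)))) c′
      ]′ (odd-+⁻ (length (z ∷ bs)) (length (as ++ z ∷ cs)) (trans (cong odd (sym total)) o))
      where
      total : length (as ++ z ∷ bs ++ z ∷ cs) ≡ length (z ∷ bs) + length (as ++ z ∷ cs)
      total = length-repeats as z bs cs
      0<rest : 0 < length (as ++ z ∷ cs)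
      0<rest = subst (0 <_) (sym (length-++-sucʳ as z cs)) (s≤s z≤n)

TwoColourable : ∀ {A : Set} → (A → A → Set) → Set
TwoColourable {A} R = Σ (A → Bool) λ c → ∀ {u v} → R u v → c u ≢ c v

alternating-last : ∀ m (f : Fin (suc m) → Bool) → (∀ i → f (inject₁ i) ≢ f (fsuc i)) →
                   f (fromℕ m) ≡ f fzero xor odd m
alternating-last zero    f alt = sym (xor-identityʳ (f fzero))
alternating-last (suc m) f alt = begin
  f (fromℕ (suc m))            ≡⟨ ¬-not (≢-sym (alt (fromℕ m))) ⟩
  not (f (inject₁ (fromℕ m)))  ≡⟨ cong not (alternating-last m (f ∘ inject₁) (alt ∘ inject₁)) ⟩
  not (f fzero xor odd m)      ≡⟨ not-distribʳ-xor (f fzero) (odd m) ⟩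
  f fzero xor odd (suc m)      ∎
  where open ≡-Reasoning

module _ {n : ℕ} (G : SimpleGraph n) where

  module _ {R : Fin n → Fin n → Set} (adj⇒R : ∀ {u v} → Adj G u v → R u v) where

    walk-◅ : ∀ {a b c k xs} → Walk G a b k → Path R b c xs →
             ∃[ ys ] (Path R a c ys × length ys ≡ k + length xs)
    walk-◅ nil        p = _ , p , refl
    walk-◅ (cons e w) p = let (ys , q , eq) = walk-◅ w p in _ , adj⇒R e ◅ q , cong suc eq

    reverseWalk-◅ : ∀ {a b c k xs} → Walk G a b k → Path R a c xs →
                    ∃[ ys ] (Path R b c ys × length ys ≡ k + length xs)
    reverseWalk-◅         nil                p = _ , p , refl
    reverseWalk-◅ {xs = xs} (cons {k = k} e w) p =
      let (ys , q , eq) = reverseWalk-◅ w (adj⇒R (symAdj G e) ◅ p)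
      in ys , q , trans eq (+-suc k (length xs))

  AdjOrAntipodal-irrefl : ∀ {u} → ¬ AdjOrAntipodal G u u
  AdjOrAntipodal-irrefl (inj₁ a)         = irrAdj G a
  AdjOrAntipodal-irrefl (inj₂ (u≢u , _)) = u≢u refl

  uniqueClosedWalk⇒ADCycle : ∀ {y ys} → 2 ≤ length ys → Unique (y ∷ ys) →
                             ClosedWalk (AdjOrAntipodal G) (y ∷ ys) → ADCycle G (length ys)
  uniqueClosedWalk⇒ADCycle {y} {ys} 2≤ u w = record
    { len≥3    = s≤s 2≤
    ; vert     = lookup (y ∷ ys)
    ; distinct = lookup-injective u
    ; step     = Path-step w
    ; close    = Path-close w
    }

  allADCyclesEven⇒noOddClosedWalk : AllADCyclesEven G → ∀ xs →
    ClosedWalk (AdjOrAntipodal G) xs → odd (length xs) ≡ true → ⊥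
  allADCyclesEven⇒noOddClosedWalk even xs w o with oddClosedWalk⇒oddCycle _≟_ xs w o
  ... | _ ∷ []                , _ , edge r , _  = AdjOrAntipodal-irrefl r
  ... | _ ∷ _ ∷ []            , _ , _      , ()
  ... | _ ∷ _ ∷ _ ∷ _         , u , c      , o′
    with trans (sym o′) (2∣⇒odd≡false (even _ (uniqueClosedWalk⇒ADCycle (s≤s (s≤s z≤n)) u c)))
  ...   | ()

  module _ (conn : Connected G) (v₀ : Fin n) where

    walkParity : Fin n → Bool
    walkParity v = odd (proj₁ (conn v₀ v))

    closedWalkThrough : ∀ {u v} → AdjOrAntipodal G u v →
      ∃[ ys ] (ClosedWalk (AdjOrAntipodal G) (v ∷ ys)
               × length ys ≡ proj₁ (conn v₀ v) + proj₁ (conn v₀ u))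
    closedWalkThrough {u} {v} r =
      let (xs , p , eq₁) = walk-◅ inj₁ (proj₂ (conn v₀ u)) (edge r)
          (ys , q , eq₂) = reverseWalk-◅ inj₁ (proj₂ (conn v₀ v)) p
      in ys , q , trans eq₂ (cong (proj₁ (conn v₀ v) +_) (trans eq₁ (+-identityʳ _)))

    walkParity-proper : AllADCyclesEven G → ∀ {u v} → AdjOrAntipodal G u v →
                        walkParity u ≢ walkParity v
    walkParity-proper even {u} {v} r same =
      let (ys , w , eq) = closedWalkThrough r
          kᵤ = proj₁ (conn v₀ u)
          kᵥ = proj₁ (conn v₀ v)
      in allADCyclesEven⇒noOddClosedWalk even (v ∷ ys) w (begin
        not (odd (length ys))            ≡⟨ cong (not ∘ odd) eq ⟩
        not (odd (kᵥ + kᵤ))              ≡⟨ cong not (odd-+ kᵥ kᵤ) ⟩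
        not (odd kᵥ xor odd kᵤ)          ≡⟨ cong (λ b → not (odd kᵥ xor b)) same ⟩
        not (odd kᵥ xor odd kᵥ)          ≡⟨ cong not (xor-same (odd kᵥ)) ⟩
        true                             ∎)
      where open ≡-Reasoning

  allADCyclesEven⇒twoColourable : Connected G → Fin n → AllADCyclesEven G →
                                  TwoColourable (AdjOrAntipodal G)
  allADCyclesEven⇒twoColourable conn v₀ even = walkParity conn v₀ , walkParity-proper conn v₀ even

  twoColourable⇒allADCyclesEven : TwoColourable (AdjOrAntipodal G) → AllADCyclesEven G
  twoColourable⇒allADCyclesEven (c , proper) m cycle = odd≡false⇒2∣ (suc m) (cong not oddLength)
    where
    open ADCycle cycle
    oddLength : odd m ≡ true
    oddLength with odd m | alternating-last m (c ∘ vert) (λ i → proper (step i))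
    ... | true  | _    = refl
    ... | false | last = ⊥-elim (proper close (trans last (xor-identityʳ _)))

  diametricalBipartite⇔twoColourable : DiametricalBipartite G ⇔ TwoColourable (AdjOrAntipodal G)
  diametricalBipartite⇔twoColourable = mk⇔
    (λ (c , bip , anti) → c , λ {u} {v} → [ bip u v , anti u v ]′)
    (λ (c , proper) → c , (λ _ _ → proper ∘ inj₁) , (λ _ _ → proper ∘ inj₂))

  weightedBipartite⇔twoColourable : WeightedBipartite G ⇔ TwoColourable (AdjOrAntipodal G)
  weightedBipartite⇔twoColourable = mk⇔
    (λ (c , proper) → c , λ {u} {v} → [ (λ a → proper u v 1 (inj₁ (a , refl)))
                                     , (λ { ap@(_ , d , diam , _) → proper u v d (inj₂ (ap , d , diam , refl)) }) ]′)
    (λ (c , proper) → c , λ { _ _ _ (inj₁ (a , _)) → proper (inj₁ a) ; _ _ _ (inj₂ (ap , _)) → proper (inj₂ ap) })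

mainTheorem7 : ∀ {n : ℕ} (G : SimpleGraph n) → 3 ≤ n → Connected G →
    (DiametricalBipartite G ⇔ WeightedBipartite G)
      × (WeightedBipartite G ⇔ AllADCyclesEven G)
      × (AllADCyclesEven G ⇔ DiametricalBipartite G)
mainTheorem7 {suc n} G _ conn =
  ⇔.trans i⇔col (⇔.sym ii⇔col) , ⇔.trans ii⇔col (⇔.sym iii⇔col) , ⇔.trans iii⇔col (⇔.sym i⇔col)
  where
  i⇔col : DiametricalBipartite G ⇔ TwoColourable (AdjOrAntipodal G)
  i⇔col = diametricalBipartite⇔twoColourable G
  ii⇔col : WeightedBipartite G ⇔ TwoColourable (AdjOrAntipodal G)
  ii⇔col = weightedBipartite⇔twoColourable G
  iii⇔col : AllADCyclesEven G ⇔ TwoColourable (AdjOrAntipodal G)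
  iii⇔col = mk⇔ (allADCyclesEven⇒twoColourable G conn fzero) (twoColourable⇒allADCyclesEven G)
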